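{- Let $\mathcal{X}$ be a symmetric configuration $v_3$ with point set $V$ and strong chromatic number $5$. Suppose there exist a set $S\subseteq V$ with $|S|\leq 2$ and a map $c$ from $V\setminus S$ to a set of $4$ colours such that any two distinct points of $V\setminus S$ lying in a common block receive different colours. Then the weak chromatic number of $\mathcal{X}$ is $2$ (equivalently, $\mathcal{X}$ has a blocking set).
   Context: A symmetric configuration $v_3$ is a finite incidence structure consisting of a set $V$ of $v$ points and a collection of $v$ blocks, each block a $3$-element subset of $V$, such that each point lies in exactly $3$ blocks and any two distinct points lie together in at most one block. A strong colouring assigns colours to points so that the three points of every block receive distinct colours; the strong chromatic number is the least number of colours in a strong colouring. A weak colouring assigns colours to points so that no block is monochromatic; the weak chromatic number is the least number of colours in a weak colouring. A blocking set is a subset $Q\subseteq V$ such that every block meets both $Q$ and $V\setminus Q$. -}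

module Defs where

open import Data.Nat using (ℕ; zero; suc; _+_; _≤_; _<_)
open import Data.Fin using (Fin; zero; suc)
open import Data.Fin.Properties using (any?)
open import Data.Fin.Subset using (Subset; _∈_; _∉_; ∣_∣)
open import Data.Product using (Σ; ∃; ∃-syntax; _×_; _,_)
open import Relation.Binary.PropositionalEquality using (_≡_; _≢_)
open import Relation.Nullary using (¬_; Dec; yes; no)
open import Data.Fin using (_≟_)

-- A finite incidence structure with v points (Fin v) and v blocks (indexed by Fin v);
-- block j consists of the points blk j 0, blk j 1, blk j 2.
Blocks : ℕ → Set
Blocks v = Fin v → Fin 3 → Fin v

inBlock? : ∀ {v} (blk : Blocks v) (j : Fin v) (p : Fin v) → Dec (∃[ i ] blk j i ≡ p)
inBlock? blk j p = any? (λ i → blk j i ≟ p)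

countFin : ∀ {n} {P : Fin n → Set} → (∀ j → Dec (P j)) → ℕ
countFin {zero} d = 0
countFin {suc n} d with d zero
... | yes _ = suc (countFin (λ j → d (suc j)))
... | no _ = countFin (λ j → d (suc j))

degree : ∀ {v} → Blocks v → Fin v → ℕ
degree blk p = countFin (λ j → inBlock? blk j p)

record IsConfiguration {v : ℕ} (blk : Blocks v) : Set where
  field
    blockDistinct : ∀ j (i i' : Fin 3) → i ≢ i' → blk j i ≢ blk j i'
    pointDegree : ∀ p → degree blk p ≡ 3
    atMostOne : ∀ (p q : Fin v) → p ≢ q → ∀ j j' →
      (∃[ i ] blk j i ≡ p) → (∃[ i ] blk j i ≡ q) →
      (∃[ i ] blk j' i ≡ p) → (∃[ i ] blk j' i ≡ q) → j ≡ j'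

StrongColouring : ∀ {v} → Blocks v → ℕ → Set
StrongColouring {v} blk k =
  Σ (Fin v → Fin k) λ col → ∀ j (i i' : Fin 3) → i ≢ i' → col (blk j i) ≢ col (blk j i')

WeakColouring : ∀ {v} → Blocks v → ℕ → Set
WeakColouring {v} blk k =
  Σ (Fin v → Fin k) λ col → ∀ j → ¬ (∀ (i i' : Fin 3) → col (blk j i) ≡ col (blk j i'))

StrongChromaticNumber : ∀ {v} → Blocks v → ℕ → Set
StrongChromaticNumber blk k = StrongColouring blk k × (∀ m → m < k → ¬ StrongColouring blk m)

WeakChromaticNumber : ∀ {v} → Blocks v → ℕ → Set
WeakChromaticNumber blk k = WeakColouring blk k × (∀ m → m < k → ¬ WeakColouring blk m)

PartialProper : ∀ {v} → Blocks v → (S : Subset v) → ((p : Fin v) → p ∉ S → Fin 4) → Set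
PartialProper {v} blk S c =
  ∀ (p q : Fin v) (hp : p ∉ S) (hq : q ∉ S) → p ≢ q →
  ∀ j → (∃[ i ] blk j i ≡ p) → (∃[ i ] blk j i ≡ q) → c p hp ≢ c q hq

-- Each of the three partitions π of the four colours into two pairs turns the colouring c
-- of V ∖ S into a 2-colouring, and the at most two points s₁, s₂ covering S get colours
-- a₁, a₂ chosen freely. A block avoiding s₁, s₂ has three distinct colours, so it is never
-- monochromatic. A block through s₁ but not s₂ is monochromatic only if its other two points
-- lie on side a₁ of π, and a block through both only forbids a₁ = a₂. Two distinct colours
-- determine their pair, so each block forces at most one choice (π, a). If none of the twelve
-- choices of (π, a₁, a₂) worked, the forcing blocks together with a block through s₁ and s₂
-- would give four distinct blocks through s₁ or s₂, whereas every point lies on exactly three.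

module Submission where

open import Defs
open import Data.Bool using (if_then_else_)
open import Data.Nat using (ℕ; zero; suc; _≤_; _<_; z≤n; s≤s)
open import Data.Nat.Properties using (m≤n⇒m≤1+n; <⇒≤; <-≤-trans; ≤-pred; n≮0)
open import Data.Fin using (Fin; zero; suc; _≟_; punchIn)
open import Data.Fin.Properties using (any?; all?; punchInᵢ≢i; punchIn-injective)
open import Data.Fin.Subset using (Subset; _∈_; _∉_; ∣_∣; _-_)
open import Data.Fin.Subset.Properties using (_∈?_; nonempty?; x∈p⇒∣p-x∣<∣p∣; x∈p∧x≢y⇒x∈p-y)
open import Data.List using (List; []; _∷_; length)
open import Data.List.Relation.Unary.All as All using (All; []; _∷_)
open import Data.List.Relation.Unary.AllPairs using ([]; _∷_)
open import Data.List.Relation.Unary.Unique.Propositional using (Unique)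
open import Data.Vec using (Vec; []; _∷_; replicate)
open import Data.Vec.Relation.Unary.Any using (here; there)
open import Data.Vec.Membership.Propositional using () renaming (_∈_ to _∈ᵥ_)
open import Data.Product using (Σ; ∃; ∃-syntax; _×_; _,_; proj₁; proj₂)
open import Data.Sum as Sum using (_⊎_; inj₁; inj₂)
open import Data.Empty using (⊥; ⊥-elim)
open import Function using (_∘_; case_of_)
open import Relation.Nullary using (¬_; Dec; yes; no; ¬?; does)
open import Relation.Nullary.Decidable using (_×-dec_; _⊎-dec_; _→-dec_; toWitness)
open import Relation.Binary.PropositionalEquality using (_≡_; _≢_; refl; sym; trans; cong; subst; module ≡-Reasoning)

countFin-mono : ∀ {n} {P Q : Fin n → Set} (dP : ∀ j → Dec (P j)) (dQ : ∀ j → Dec (Q j)) →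
  (∀ j → Q j → P j) → countFin dQ ≤ countFin dP
countFin-mono {zero}  dP dQ Q⊆P = z≤n
countFin-mono {suc n} dP dQ Q⊆P with dP zero | dQ zero
... | yes _ | yes _ = s≤s (countFin-mono (dP ∘ suc) (dQ ∘ suc) (Q⊆P ∘ suc))
... | yes _ | no _  = m≤n⇒m≤1+n (countFin-mono (dP ∘ suc) (dQ ∘ suc) (Q⊆P ∘ suc))
... | no ¬p | yes q = ⊥-elim (¬p (Q⊆P zero q))
... | no _  | no _  = countFin-mono (dP ∘ suc) (dQ ∘ suc) (Q⊆P ∘ suc)

countFin-mono-strict : ∀ {n} {P Q : Fin n → Set} (dP : ∀ j → Dec (P j)) (dQ : ∀ j → Dec (Q j)) →
  (∀ j → Q j → P j) → ∀ j₀ → P j₀ → ¬ Q j₀ → countFin dQ < countFin dP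
countFin-mono-strict dP dQ Q⊆P zero p ¬q with dP zero | dQ zero
... | yes _ | yes q = ⊥-elim (¬q q)
... | yes _ | no _  = s≤s (countFin-mono (dP ∘ suc) (dQ ∘ suc) (Q⊆P ∘ suc))
... | no ¬p | _     = ⊥-elim (¬p p)
countFin-mono-strict dP dQ Q⊆P (suc j₀) p ¬q with dP zero | dQ zero
... | yes _ | yes _ = s≤s (countFin-mono-strict (dP ∘ suc) (dQ ∘ suc) (Q⊆P ∘ suc) j₀ p ¬q)
... | yes _ | no _  = s≤s (<⇒≤ (countFin-mono-strict (dP ∘ suc) (dQ ∘ suc) (Q⊆P ∘ suc) j₀ p ¬q))
... | no ¬p | yes q = ⊥-elim (¬p (Q⊆P zero q))
... | no _  | no _  = countFin-mono-strict (dP ∘ suc) (dQ ∘ suc) (Q⊆P ∘ suc) j₀ p ¬q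

length≤countFin : ∀ {n} {P : Fin n → Set} (dP : ∀ j → Dec (P j)) {js : List (Fin n)} →
  Unique js → All P js → length js ≤ countFin dP
length≤countFin dP []            []         = z≤n
length≤countFin {P = P} dP {j ∷ js} (j∉js ∷ u) (pj ∷ ps) =
  <-≤-trans (s≤s (length≤countFin dQ u (All.zip (ps , j∉js))))
            (countFin-mono-strict dP dQ (λ _ → proj₁) j pj (λ q → proj₂ q refl))
  where
  dQ : ∀ i → Dec (P i × j ≢ i)
  dQ i = dP i ×-dec ¬? (j ≟ i)

-- π names the partner of colour 0 among the colours 1, 2, 3.
pairing : Fin 3 → Fin 4 → Fin 2
pairing π zero    = zero
pairing π (suc x) = if does (x ≟ π) then zero else suc zero

pairing-noThreeInClass : ∀ π x y z → x ≢ y → x ≢ z → y ≢ z →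
  pairing π x ≡ pairing π y → pairing π x ≢ pairing π z
pairing-noThreeInClass = toWitness {a? = all? λ π → all? λ x → all? λ y → all? λ z →
  ¬? (x ≟ y) →-dec ¬? (x ≟ z) →-dec ¬? (y ≟ z) →-dec
  (pairing π x ≟ pairing π y) →-dec ¬? (pairing π x ≟ pairing π z)} _

pairing-classDeterminesPartition : ∀ π π' x y → x ≢ y →
  pairing π x ≡ pairing π y → pairing π' x ≡ pairing π' y → π ≡ π'
pairing-classDeterminesPartition = toWitness {a? = all? λ π → all? λ π' → all? λ x → all? λ y →
  ¬? (x ≟ y) →-dec (pairing π x ≟ pairing π y) →-dec (pairing π' x ≟ pairing π' y) →-dec (π ≟ π')} _

pairing-sameSide : ∀ {π π' x y a a'} → x ≢ y →
  pairing π x ≡ a → pairing π y ≡ a → pairing π' x ≡ a' → pairing π' y ≡ a' → (π , a) ≡ (π' , a')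
pairing-sameSide {π} {π'} {x} x≢y refl πy refl π'y
  with refl ← pairing-classDeterminesPartition π π' x _ x≢y (sym πy) (sym π'y) = refl

coveredBy : ∀ {n} k (S : Subset n) → ∣ S ∣ ≤ k → Fin n →
  Σ (Vec (Fin n) k) λ xs → ∀ {p} → p ∈ S → p ∈ᵥ xs
coveredBy zero    S ∣S∣≤0 _ = [] , λ p∈S → ⊥-elim (n≮0 (<-≤-trans (x∈p⇒∣p-x∣<∣p∣ p∈S) ∣S∣≤0))
coveredBy (suc k) S ∣S∣≤k+1 p₀ with nonempty? S
... | no empty = replicate _ p₀ , λ {p} p∈S → ⊥-elim (empty (p , p∈S))
... | yes (x , x∈S) with coveredBy k (S - x) (≤-pred (<-≤-trans (x∈p⇒∣p-x∣<∣p∣ x∈S) ∣S∣≤k+1)) p₀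
...   | xs , covers = x ∷ xs , cover
  where
  cover : ∀ {p} → p ∈ S → p ∈ᵥ x ∷ xs
  cover {p} p∈S with p ≟ x
  ... | yes p≡x = here p≡x
  ... | no  p≢x = there (covers (x∈p∧x≢y⇒x∈p-y p∈S p≢x))

∀⊎⇒⊎∀ : ∀ {n} {A : Set} {B : Fin n → Set} → (∀ i → A ⊎ B i) → A ⊎ (∀ i → B i)
∀⊎⇒⊎∀ {zero}  f = inj₂ λ ()
∀⊎⇒⊎∀ {suc n} f with f zero | ∀⊎⇒⊎∀ (f ∘ suc)
... | inj₁ a  | _       = inj₁ a
... | inj₂ _  | inj₁ a  = inj₁ a
... | inj₂ b₀ | inj₂ bs = inj₂ λ { zero → b₀ ; (suc i) → bs i }

toggle : Fin 2 → Fin 2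
toggle zero       = suc zero
toggle (suc zero) = zero

toggle≢ : ∀ a → toggle a ≢ a
toggle≢ zero       ()
toggle≢ (suc zero) ()

module Configuration {v : ℕ} (blk : Blocks v) (conf : IsConfiguration blk) where

  open IsConfiguration conf

  _∈ᵇ_ : Fin v → Fin v → Set
  p ∈ᵇ j = ∃[ i ] blk j i ≡ p

  Monochromatic : ∀ {k} → (Fin v → Fin k) → Fin v → Set
  Monochromatic col j = ∀ i i' → col (blk j i) ≡ col (blk j i')

  weak-or-monochromatic : ∀ {k} (col : Fin v → Fin k) → WeakColouring blk k ⊎ ∃ (Monochromatic col)
  weak-or-monochromatic col with any? (λ j → all? λ i → all? λ i' → col (blk j i) ≟ col (blk j i'))
  ... | yes mono  = inj₂ mono
  ... | no  ¬mono = inj₁ (col , λ j m → ¬mono (j , m))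

  noFourBlocksThrough : ∀ {p j₁ j₂ j₃ j₄} →
    Unique (j₁ ∷ j₂ ∷ j₃ ∷ j₄ ∷ []) → All (p ∈ᵇ_) (j₁ ∷ j₂ ∷ j₃ ∷ j₄ ∷ []) → ⊥
  noFourBlocksThrough {p} u ps
    with subst (4 ≤_) (pointDegree p) (length≤countFin (λ j → inBlock? blk j p) u ps)
  ... | s≤s (s≤s (s≤s ()))

  module TwoColouring (S : Subset v) (c : (p : Fin v) → p ∉ S → Fin 4) (proper : PartialProper blk S c)
                      (s₁ s₂ : Fin v) (covers : ∀ {p} → p ∈ S → p ∈ᵥ s₁ ∷ s₂ ∷ []) where

    Ordinary : Fin v → Set
    Ordinary p = p ≢ s₁ × p ≢ s₂

    ordinary? : ∀ p → Dec (Ordinary p)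
    ordinary? p = ¬? (p ≟ s₁) ×-dec ¬? (p ≟ s₂)

    ordinary⇒∉S : ∀ {p} → Ordinary p → p ∉ S
    ordinary⇒∉S (≢s₁ , ≢s₂) p∈S with covers p∈S
    ... | here ≡s₁         = ≢s₁ ≡s₁
    ... | there (here ≡s₂) = ≢s₂ ≡s₂

    -- the value 0 on S is junk: only colours of ordinary points are ever inspected
    colour : Fin v → Fin 4
    colour p with p ∈? S
    ... | yes _   = zero
    ... | no  p∉S = c p p∉S

    colour-proper : ∀ {p q j} → Ordinary p → Ordinary q → p ≢ q → p ∈ᵇ j → q ∈ᵇ j → colour p ≢ colour q
    colour-proper {p} {q} {j} op oq p≢q p∈j q∈j with p ∈? S | q ∈? S
    ... | yes p∈S | _       = ⊥-elim (ordinary⇒∉S op p∈S)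
    ... | no _    | yes q∈S = ⊥-elim (ordinary⇒∉S oq q∈S)
    ... | no p∉S  | no q∉S  = proper p q p∉S q∉S p≢q j p∈j q∈j

    twoColouring : Fin 3 → Fin 2 → Fin 2 → Fin v → Fin 2
    twoColouring π a₁ a₂ p with p ≟ s₁
    ... | yes _ = a₁
    ... | no  _ with p ≟ s₂
    ...   | yes _ = a₂
    ...   | no  _ = pairing π (colour p)

    twoColouring-s₁ : ∀ {π a₁ a₂} → twoColouring π a₁ a₂ s₁ ≡ a₁
    twoColouring-s₁ with s₁ ≟ s₁
    ... | yes _     = refl
    ... | no  s₁≢s₁ = ⊥-elim (s₁≢s₁ refl)

    twoColouring-s₂ : ∀ {π a₁ a₂} → s₂ ≢ s₁ → twoColouring π a₁ a₂ s₂ ≡ a₂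
    twoColouring-s₂ s₂≢s₁ with s₂ ≟ s₁
    ... | yes s₂≡s₁ = ⊥-elim (s₂≢s₁ s₂≡s₁)
    ... | no  _ with s₂ ≟ s₂
    ...   | yes _     = refl
    ...   | no  s₂≢s₂ = ⊥-elim (s₂≢s₂ refl)

    twoColouring-ordinary : ∀ {π a₁ a₂ p} → Ordinary p → twoColouring π a₁ a₂ p ≡ pairing π (colour p)
    twoColouring-ordinary {p = p} (≢s₁ , ≢s₂) with p ≟ s₁
    ... | yes ≡s₁ = ⊥-elim (≢s₁ ≡s₁)
    ... | no  _ with p ≟ s₂
    ...   | yes ≡s₂ = ⊥-elim (≢s₂ ≡s₂)
    ...   | no  _   = refl

    -- Block j would be monochromatic if s received colour a.
    Forced : Fin 3 → Fin v → Fin 2 → Fin v → Set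
    Forced π s a j = s ∈ᵇ j × (∀ i → blk j i ≡ s ⊎ (Ordinary (blk j i) × pairing π (colour (blk j i)) ≡ a))

    ForcedAt : Fin 3 → Fin v → Fin 2 → Set
    ForcedAt π s a = ∃ (Forced π s a)

    forcedAt? : ∀ π s a → Dec (ForcedAt π s a)
    forcedAt? π s a = any? λ j → inBlock? blk j s ×-dec all? λ i →
      (blk j i ≟ s) ⊎-dec (ordinary? (blk j i) ×-dec (pairing π (colour (blk j i)) ≟ a))

    forced-other : ∀ {π s a j} → Forced π s a j → ∀ i → blk j i ≢ s →
      Ordinary (blk j i) × pairing π (colour (blk j i)) ≡ a
    forced-other (_ , others) i ≢s with others i
    ... | inj₁ ≡s    = ⊥-elim (≢s ≡s)
    ... | inj₂ other = other

    forced-sameBlock : ∀ {π π' s a a' j} → Forced π s a j → Forced π' s a' j → (π , a) ≡ (π' , a')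
    forced-sameBlock {s = s} {j = j} f@((i₀ , i₀≡s) , _) f' =
      pairing-sameSide
        (colour-proper (proj₁ (other f zero)) (proj₁ (other f one)) p₀≢p₁ (i zero , refl) (i one , refl))
        (proj₂ (other f zero)) (proj₂ (other f one)) (proj₂ (other f' zero)) (proj₂ (other f' one))
      where
      one : Fin 2
      one = suc zero
      i : Fin 2 → Fin 3
      i = punchIn i₀
      p₀≢p₁ : blk j (i zero) ≢ blk j (i one)
      p₀≢p₁ = blockDistinct j (i zero) (i one) (λ e → case punchIn-injective i₀ zero one e of λ ())
      other : ∀ {π a} → Forced π s a j → ∀ k → Ordinary (blk j (i k)) × pairing π (colour (blk j (i k))) ≡ a
      other g k = forced-other g (i k) λ ≡s → blockDistinct j (i k) i₀ (punchInᵢ≢i i₀ k) (trans ≡s (sym i₀≡s))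

    forced-distinct : ∀ {π π' s a a' j j'} → Forced π s a j → Forced π' s a' j' →
      (π , a) ≢ (π' , a') → j ≢ j'
    forced-distinct f f' ne refl = ne (forced-sameBlock f f')

    forced-avoidsSpecial : ∀ {π s a j j' q} → Forced π s a j → q ∈ᵇ j' → q ≢ s → ¬ Ordinary q → j ≢ j'
    forced-avoidsSpecial f (i , refl) q≢s ¬ordinary refl = ¬ordinary (proj₁ (forced-other f i q≢s))

    Shared : Set
    Shared = s₁ ≢ s₂ × ∃[ j ] (s₁ ∈ᵇ j × s₂ ∈ᵇ j)

    Failure : Fin 3 → Fin 2 → Fin 2 → Set
    Failure π a₁ a₂ = ForcedAt π s₁ a₁ ⊎ ForcedAt π s₂ a₂ ⊎ (Shared × a₁ ≡ a₂)

    module _ {π : Fin 3} {a₁ a₂ : Fin 2} {j : Fin v} (mono : Monochromatic (twoColouring π a₁ a₂) j) where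

      open ≡-Reasoning

      monochromatic⇒forced : ∀ {s i₀} → blk j i₀ ≡ s → (∀ i → blk j i ≢ s → Ordinary (blk j i)) →
        Forced π s (twoColouring π a₁ a₂ s) j
      monochromatic⇒forced {s} {i₀} i₀≡s ordinary = (i₀ , i₀≡s) , other
        where
        other : ∀ i → blk j i ≡ s ⊎ (Ordinary (blk j i) × pairing π (colour (blk j i)) ≡ twoColouring π a₁ a₂ s)
        other i with blk j i ≟ s
        ... | yes ≡s = inj₁ ≡s
        ... | no  ≢s = inj₂ (ordinary i ≢s , (begin
          pairing π (colour (blk j i))      ≡⟨ twoColouring-ordinary (ordinary i ≢s) ⟨
          twoColouring π a₁ a₂ (blk j i)    ≡⟨ mono i i₀ ⟩
          twoColouring π a₁ a₂ (blk j i₀)   ≡⟨ cong (twoColouring π a₁ a₂) i₀≡s ⟩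
          twoColouring π a₁ a₂ s            ∎))

      monochromatic⇒¬allOrdinary : ¬ (∀ i → Ordinary (blk j i))
      monochromatic⇒¬allOrdinary ordinary =
        pairing-noThreeInClass π _ _ _ (distinct zero one (λ ())) (distinct zero two (λ ())) (distinct one two (λ ()))
          (sameSide zero one) (sameSide zero two)
        where
        one two : Fin 3
        one = suc zero
        two = suc (suc zero)
        distinct : ∀ i i' → i ≢ i' → colour (blk j i) ≢ colour (blk j i')
        distinct i i' i≢i' = colour-proper (ordinary i) (ordinary i') (blockDistinct j i i' i≢i') (i , refl) (i' , refl)
        sameSide : ∀ i i' → pairing π (colour (blk j i)) ≡ pairing π (colour (blk j i'))
        sameSide i i' = begin
          pairing π (colour (blk j i))     ≡⟨ twoColouring-ordinary (ordinary i) ⟨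
          twoColouring π a₁ a₂ (blk j i)   ≡⟨ mono i i' ⟩
          twoColouring π a₁ a₂ (blk j i')  ≡⟨ twoColouring-ordinary (ordinary i') ⟩
          pairing π (colour (blk j i'))    ∎

      monochromatic⇒failure : Failure π a₁ a₂
      monochromatic⇒failure with inBlock? blk j s₁
      ... | yes (i₁ , i₁≡s₁) with inBlock? blk j s₂ ×-dec ¬? (s₁ ≟ s₂)
      ...   | yes ((i₂ , i₂≡s₂) , s₁≢s₂) = inj₂ (inj₂ ((s₁≢s₂ , j , (i₁ , i₁≡s₁) , (i₂ , i₂≡s₂)) , (begin
              a₁                              ≡⟨ twoColouring-s₁ ⟨
              twoColouring π a₁ a₂ s₁         ≡⟨ cong (twoColouring π a₁ a₂) i₁≡s₁ ⟨
              twoColouring π a₁ a₂ (blk j i₁) ≡⟨ mono i₁ i₂ ⟩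
              twoColouring π a₁ a₂ (blk j i₂) ≡⟨ cong (twoColouring π a₁ a₂) i₂≡s₂ ⟩
              twoColouring π a₁ a₂ s₂         ≡⟨ twoColouring-s₂ (s₁≢s₂ ∘ sym) ⟩
              a₂                              ∎)))
      ...   | no ¬shared =
              inj₁ (j , subst (λ a → Forced π s₁ a j) twoColouring-s₁ (monochromatic⇒forced i₁≡s₁ ordinary))
        where
        ordinary : ∀ i → blk j i ≢ s₁ → Ordinary (blk j i)
        ordinary i ≢s₁ = ≢s₁ , λ ≡s₂ → ¬shared ((i , ≡s₂) , λ s₁≡s₂ → ≢s₁ (trans ≡s₂ (sym s₁≡s₂)))
      monochromatic⇒failure | no s₁∉j with inBlock? blk j s₂
      ... | yes (i₂ , i₂≡s₂) =
        inj₂ (inj₁ (j , subst (λ a → Forced π s₂ a j) (twoColouring-s₂ s₂≢s₁) (monochromatic⇒forced i₂≡s₂ ordinary)))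
        where
        s₂≢s₁ : s₂ ≢ s₁
        s₂≢s₁ s₂≡s₁ = s₁∉j (i₂ , trans i₂≡s₂ s₂≡s₁)
        ordinary : ∀ i → blk j i ≢ s₂ → Ordinary (blk j i)
        ordinary i ≢s₂ = (λ ≡s₁ → s₁∉j (i , ≡s₁)) , ≢s₂
      ... | no s₂∉j = ⊥-elim (monochromatic⇒¬allOrdinary λ i → (λ ≡s₁ → s₁∉j (i , ≡s₁)) , (λ ≡s₂ → s₂∉j (i , ≡s₂)))

    weak-or-failures : ∀ π → WeakColouring blk 2 ⊎ (∀ a₁ a₂ → Failure π a₁ a₂)
    weak-or-failures π = ∀⊎⇒⊎∀ λ a₁ → ∀⊎⇒⊎∀ λ a₂ →
      Sum.map₂ (λ (_ , mono) → monochromatic⇒failure mono) (weak-or-monochromatic (twoColouring π a₁ a₂))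

    ForcedBothWays : Fin 3 → Fin v → Set
    ForcedBothWays π s = ForcedAt π s zero × ForcedAt π s (suc zero)

    CommonlyForced : Fin 3 → Set
    CommonlyForced π = Shared × ∃[ a ] (ForcedAt π s₁ a × ForcedAt π s₂ a)

    Obstructed : Fin 3 → Set
    Obstructed π = (ForcedBothWays π s₁ ⊎ ForcedBothWays π s₂) ⊎ CommonlyForced π

    unforcedSide : ∀ {π s} → ¬ ForcedBothWays π s → ∃[ a ] ¬ ForcedAt π s a
    unforcedSide {π} {s} ¬both with forcedAt? π s zero
    ... | no  ¬f₀ = zero , ¬f₀
    ... | yes f₀  = suc zero , λ f₁ → ¬both (f₀ , f₁)

    failures⇒obstructed : ∀ {π} → (∀ a₁ a₂ → Failure π a₁ a₂) → Obstructed π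
    failures⇒obstructed {π} fail with forcedAt? π s₁ zero ×-dec forcedAt? π s₁ (suc zero)
                                    | forcedAt? π s₂ zero ×-dec forcedAt? π s₂ (suc zero)
    ... | yes both₁ | _         = inj₁ (inj₁ both₁)
    ... | no _      | yes both₂ = inj₁ (inj₂ both₂)
    ... | no ¬both₁ | no ¬both₂ = inj₂ (commonlyForced (unforcedSide ¬both₁) (unforcedSide ¬both₂))
      where
      -- Two unforced sides a₁, a₂ fail only through the shared block, so a₁ = a₂; the
      -- colourings (toggle a₁, a₁) and (a₁, toggle a₁) then fail only by forcing toggle a₁.
      commonlyForced : ∃[ a ] ¬ ForcedAt π s₁ a → ∃[ a ] ¬ ForcedAt π s₂ a → CommonlyForced π
      commonlyForced (a₁ , ¬f₁) (a₂ , ¬f₂) with fail a₁ a₂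
      ... | inj₁ f₁        = ⊥-elim (¬f₁ f₁)
      ... | inj₂ (inj₁ f₂) = ⊥-elim (¬f₂ f₂)
      ... | inj₂ (inj₂ (shared , refl)) =
        shared , toggle a₁ , forced₁ (fail (toggle a₁) a₁) , forced₂ (fail a₁ (toggle a₁))
        where
        forced₁ : Failure π (toggle a₁) a₁ → ForcedAt π s₁ (toggle a₁)
        forced₁ (inj₁ f₁)             = f₁
        forced₁ (inj₂ (inj₁ f₂))      = ⊥-elim (¬f₂ f₂)
        forced₁ (inj₂ (inj₂ (_ , e))) = ⊥-elim (toggle≢ a₁ e)
        forced₂ : Failure π a₁ (toggle a₁) → ForcedAt π s₂ (toggle a₁)
        forced₂ (inj₁ f₁)             = ⊥-elim (¬f₁ f₁)
        forced₂ (inj₂ (inj₁ f₂))      = f₂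
        forced₂ (inj₂ (inj₂ (_ , e))) = ⊥-elim (toggle≢ a₁ (sym e))

    forcedBothWays-unique : ∀ {π π' s} → π ≢ π' → ForcedBothWays π s → ForcedBothWays π' s → ⊥
    forcedBothWays-unique π≢π' ((_ , f₁) , (_ , f₂)) ((_ , f₃) , (_ , f₄)) =
      noFourBlocksThrough
        ((forced-distinct f₁ f₂ (λ ()) ∷ forced-distinct f₁ f₃ partitions ∷ forced-distinct f₁ f₄ partitions ∷ []) ∷
         (forced-distinct f₂ f₃ partitions ∷ forced-distinct f₂ f₄ partitions ∷ []) ∷
         (forced-distinct f₃ f₄ (λ ()) ∷ []) ∷ [] ∷ [])
        (proj₁ f₁ ∷ proj₁ f₂ ∷ proj₁ f₃ ∷ proj₁ f₄ ∷ [])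
      where
      partitions : ∀ {a a'} → (_ , a) ≢ (_ , a')
      partitions = π≢π' ∘ cong proj₁

    sharedBlock-excludesForcedBothWays : ∀ {π π' s q a j₀} → π ≢ π' → q ≢ s → ¬ Ordinary q →
      s ∈ᵇ j₀ → q ∈ᵇ j₀ → ForcedAt π s a → ForcedBothWays π' s → ⊥
    sharedBlock-excludesForcedBothWays {s = s} {j₀ = j₀}
      π≢π' q≢s ¬ordinary s∈j₀ q∈j₀ (_ , f₁) ((_ , f₃) , (_ , f₄)) =
      noFourBlocksThrough
        ((avoids f₁ ∷ forced-distinct f₁ f₃ partitions ∷ forced-distinct f₁ f₄ partitions ∷ []) ∷
         (avoids f₃ ∘ sym ∷ avoids f₄ ∘ sym ∷ []) ∷ (forced-distinct f₃ f₄ (λ ()) ∷ []) ∷ [] ∷ [])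
        (proj₁ f₁ ∷ s∈j₀ ∷ proj₁ f₃ ∷ proj₁ f₄ ∷ [])
      where
      avoids : ∀ {π a j} → Forced π s a j → j ≢ j₀
      avoids f = forced-avoidsSpecial f q∈j₀ q≢s ¬ordinary
      partitions : ∀ {a a'} → (_ , a) ≢ (_ , a')
      partitions = π≢π' ∘ cong proj₁

    commonlyForced-excludesForcedBothWays : ∀ {π π'} → π ≢ π' → CommonlyForced π →
      ForcedBothWays π' s₁ ⊎ ForcedBothWays π' s₂ → ⊥
    commonlyForced-excludesForcedBothWays π≢π' ((s₁≢s₂ , _ , s₁∈j₀ , s₂∈j₀) , _ , f₁ , _) (inj₁ both) =
      sharedBlock-excludesForcedBothWays π≢π' (s₁≢s₂ ∘ sym) (λ o → proj₂ o refl) s₁∈j₀ s₂∈j₀ f₁ both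
    commonlyForced-excludesForcedBothWays π≢π' ((s₁≢s₂ , _ , s₁∈j₀ , s₂∈j₀) , _ , _ , f₂) (inj₂ both) =
      sharedBlock-excludesForcedBothWays π≢π' s₁≢s₂ (λ o → proj₁ o refl) s₂∈j₀ s₁∈j₀ f₂ both

    commonlyForced-notEverywhere :
      CommonlyForced zero → CommonlyForced (suc zero) → CommonlyForced (suc (suc zero)) → ⊥
    commonlyForced-notEverywhere
      ((s₁≢s₂ , j₀ , s₁∈j₀ , s₂∈j₀) , _ , (_ , f₁) , _) (_ , _ , (_ , f₂) , _) (_ , _ , (_ , f₃) , _) =
      noFourBlocksThrough
        ((forced-distinct f₁ f₂ (λ ()) ∷ forced-distinct f₁ f₃ (λ ()) ∷ avoids f₁ ∷ []) ∷
         (forced-distinct f₂ f₃ (λ ()) ∷ avoids f₂ ∷ []) ∷ (avoids f₃ ∷ []) ∷ [] ∷ [])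
        (proj₁ f₁ ∷ proj₁ f₂ ∷ proj₁ f₃ ∷ s₁∈j₀ ∷ [])
      where
      avoids : ∀ {π a j} → Forced π s₁ a j → j ≢ j₀
      avoids f = forced-avoidsSpecial f s₂∈j₀ (s₁≢s₂ ∘ sym) (λ o → proj₂ o refl)

    forcedBothWays-pigeonhole : ∀ {π₀ π₁ π₂} → π₀ ≢ π₁ → π₀ ≢ π₂ → π₁ ≢ π₂ →
      ForcedBothWays π₀ s₁ ⊎ ForcedBothWays π₀ s₂ → ForcedBothWays π₁ s₁ ⊎ ForcedBothWays π₁ s₂ →
      ForcedBothWays π₂ s₁ ⊎ ForcedBothWays π₂ s₂ → ⊥
    forcedBothWays-pigeonhole ne₀₁ _    _    (inj₁ b₀) (inj₁ b₁) _         = forcedBothWays-unique ne₀₁ b₀ b₁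
    forcedBothWays-pigeonhole ne₀₁ _    _    (inj₂ b₀) (inj₂ b₁) _         = forcedBothWays-unique ne₀₁ b₀ b₁
    forcedBothWays-pigeonhole _    ne₀₂ _    (inj₁ b₀) _         (inj₁ b₂) = forcedBothWays-unique ne₀₂ b₀ b₂
    forcedBothWays-pigeonhole _    ne₀₂ _    (inj₂ b₀) _         (inj₂ b₂) = forcedBothWays-unique ne₀₂ b₀ b₂
    forcedBothWays-pigeonhole _    _    ne₁₂ _         (inj₁ b₁) (inj₁ b₂) = forcedBothWays-unique ne₁₂ b₁ b₂
    forcedBothWays-pigeonhole _    _    ne₁₂ _         (inj₂ b₁) (inj₂ b₂) = forcedBothWays-unique ne₁₂ b₁ b₂

    obstructions-incompatible : Obstructed zero → Obstructed (suc zero) → Obstructed (suc (suc zero)) → ⊥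
    obstructions-incompatible (inj₂ c₀) (inj₂ c₁) (inj₂ c₂) = commonlyForced-notEverywhere c₀ c₁ c₂
    obstructions-incompatible (inj₂ c₀) (inj₂ c₁) (inj₁ b₂) = commonlyForced-excludesForcedBothWays (λ ()) c₀ b₂
    obstructions-incompatible (inj₂ c₀) (inj₁ b₁) _         = commonlyForced-excludesForcedBothWays (λ ()) c₀ b₁
    obstructions-incompatible (inj₁ b₀) (inj₂ c₁) _         = commonlyForced-excludesForcedBothWays (λ ()) c₁ b₀
    obstructions-incompatible (inj₁ b₀) (inj₁ _)  (inj₂ c₂) = commonlyForced-excludesForcedBothWays (λ ()) c₂ b₀
    obstructions-incompatible (inj₁ b₀) (inj₁ b₁) (inj₁ b₂) = forcedBothWays-pigeonhole (λ ()) (λ ()) (λ ()) b₀ b₁ b₂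

    weakColouring : WeakColouring blk 2
    weakColouring with ∀⊎⇒⊎∀ (λ π → Sum.map₂ failures⇒obstructed (weak-or-failures π))
    ... | inj₁ weak       = weak
    ... | inj₂ obstructed = ⊥-elim (obstructions-incompatible (obstructed _) (obstructed _) (obstructed _))

point-of-¬strongColouring₀ : ∀ {v} (blk : Blocks v) → ¬ StrongColouring blk 0 → Fin v
point-of-¬strongColouring₀ {zero}  blk ¬coloured = ⊥-elim (¬coloured ((λ ()) , λ ()))
point-of-¬strongColouring₀ {suc v} blk _         = zero

noWeakColouring<2 : ∀ {v} (blk : Blocks v) → Fin v → ∀ m → m < 2 → ¬ WeakColouring blk m
noWeakColouring<2 blk p zero       _ (col , _) with col p
... | ()
noWeakColouring<2 blk p (suc zero) _ (col , weak) = weak p λ i i' → allEqual (col (blk p i)) (col (blk p i'))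
  where
  allEqual : (x y : Fin 1) → x ≡ y
  allEqual zero zero = refl
noWeakColouring<2 blk p (suc (suc m)) (s≤s (s≤s ()))

theorem23 : ∀ {v : ℕ} (blk : Blocks v) → IsConfiguration blk →
    StrongChromaticNumber blk 5 →
    (S : Subset v) → ∣ S ∣ ≤ 2 →
    (c : (p : Fin v) → p ∉ S → Fin 4) → PartialProper blk S c →
    WeakChromaticNumber blk 2
theorem23 {v} blk conf (_ , minimal) S ∣S∣≤2 c proper with coveredBy 2 S ∣S∣≤2 point
  where
  point : Fin v
  point = point-of-¬strongColouring₀ blk (minimal 0 (s≤s z≤n))
... | s₁ ∷ s₂ ∷ [] , covers = weakColouring , noWeakColouring<2 blk s₁
  where
  open Configuration.TwoColouring blk conf S c proper s₁ s₂ covers
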